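{- Let $\mathcal{F}$ be a filter on $\omega$. The game $\mathfrak{G}(\mathcal{F}^+,[\omega]^{<\omega},\mathcal{F}^*)$ is dual to the game $\mathfrak{G}(\mathcal{F},\omega,\mathcal{F}^+)$. Therefore, in $\mathfrak{G}(\mathcal{F}^+,[\omega]^{<\omega},\mathcal{F}^*)$: (1) player I has a winning strategy if and only if $\mathcal{F}$ is $\omega$-+-diagonalizable; (2) player II has a winning strategy if and only if $\mathcal{F}$ is not weakly Ramsey.
   Context: A filter on $\omega$ is a family $\mathcal{F}\subseteq\mathcal{P}(\omega)$ closed under finite intersections and supersets and containing all cofinite subsets of $\omega$. $\mathcal{F}^+=\{X\subseteq\omega: X\cap Y\text{ infinite for all }Y\in\mathcal{F}\}$, $\mathcal{F}^*=\mathcal{P}(\omega)\setminus\mathcal{F}^+$. In $\mathfrak{G}(\mathcal{F},\omega,\mathcal{F}^+)$, at each stage $k$ player I chooses $X_k\in\mathcal{F}$ and II responds with $n_k\in X_k$; II wins iff $\{n_k:k\in\omega\}\in\mathcal{F}^+$. In $\mathfrak{G}(\mathcal{F}^+,[\omega]^{<\omega},\mathcal{F}^*)$, I chooses $X_k\in\mathcal{F}^+$ and II responds with a nonempty finite $s_k\subseteq X_k$; II wins iff $\bigcup_k s_k\in\mathcal{F}^*$. Two games are dual if for each player, that player has a winning strategy in one game iff the other player has a winning strategy in the other. $\mathcal{F}$ is $\omega$-+-diagonalizable if there are $\langle X_n\in\mathcal{F}^+:n\in\omega\rangle$ such that for each $Y\in\mathcal{F}$ there is $n$ with $X_n\setminus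 Y$ finite. An $\mathcal{F}$-tree is a tree $\mathcal{T}$ of finite sequences of natural numbers (closed under initial segments) such that for each $\bar s\in\mathcal{T}$ there is $X_{\bar s}\in\mathcal{F}$ with $\bar s^\frown n\in\mathcal{T}$ for all $n\in X_{\bar s}$; $\mathcal{F}$ is weakly Ramsey if every $\mathcal{F}$-tree has a branch (infinite sequence all of whose initial segments lie in $\mathcal{T}$) whose set of values lies in $\mathcal{F}^+$. -}

module Defs where

open import Level using (0ℓ) renaming (suc to lsuc)
open import Data.Nat using (ℕ; _<_)
open import Data.List using (List; []; _∷_; _++_; [_]; map; upTo)
open import Data.List.NonEmpty using (List⁺; toList)
open import Data.List.Relation.Unary.All using (All)
open import Data.List.Membership.Propositional using (_∈_)
open import Data.Product using (Σ; ∃; _×_; proj₁)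
open import Relation.Nullary using (¬_)
open import Relation.Binary.PropositionalEquality using (_≡_)
open import Relation.Unary using (Pred; _⊆_; _∩_; ∁)
open import Function.Bundles using (_⇔_)

SubsetOfω : Set₁
SubsetOfω = Pred ℕ 0ℓ

Finite : SubsetOfω → Set
Finite X = ∃ λ b → ∀ n → X n → n < b

Infinite : SubsetOfω → Set
Infinite X = ¬ Finite X

Cofinite : SubsetOfω → Set
Cofinite X = Finite (∁ X)

_∖_ : SubsetOfω → SubsetOfω → SubsetOfω
(X ∖ Y) n = X n × ¬ Y n

Family : Set₁
Family = Pred SubsetOfω 0ℓ

record IsFilter (F : Family) : Set₁ where
  field
    ∩-closed  : ∀ {X Y} → F X → F Y → F (X ∩ Y)
    ⊇-closed  : ∀ {X Y} → X ⊆ Y → F X → F Y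
    cofinite  : ∀ {X} → Cofinite X → F X

_⁺ : Family → SubsetOfω → Set₁
(F ⁺) X = ∀ Y → F Y → Infinite (X ∩ Y)

_* : Family → SubsetOfω → Set₁
(F *) X = ¬ (F ⁺) X

init : ∀ {a} {A : Set a} → (ℕ → A) → ℕ → List A
init f k = map f (upTo k)

range : (ℕ → ℕ) → SubsetOfω
range f m = ∃ λ k → f k ≡ m

⋃ : (ℕ → List⁺ ℕ) → SubsetOfω
⋃ s m = ∃ λ k → m ∈ toList (s k)

-- The game 𝔊(F, ω, F⁺):  I plays X_k ∈ F, II plays n_k ∈ X_k,
-- II wins iff {n_k} ∈ F⁺.

StratI-A : Family → Set₁
StratI-A F = List ℕ → Σ SubsetOfω F

StratII-A : Family → Set₁
StratII-A F = List (Σ SubsetOfω F) → (X : Σ SubsetOfω F) → Σ ℕ (proj₁ X)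

IWins-A : (F : Family) → StratI-A F → Set₁
IWins-A F τ = (n : ℕ → ℕ) → (∀ k → proj₁ (τ (init n k)) (n k)) → ¬ (F ⁺) (range n)

IIWins-A : (F : Family) → StratII-A F → Set₁
IIWins-A F σ = (X : ℕ → Σ SubsetOfω F) →
  (F ⁺) (range (λ k → proj₁ (σ (init X k) (X k))))

IHasWS-A : Family → Set₁
IHasWS-A F = Σ (StratI-A F) (IWins-A F)

IIHasWS-A : Family → Set₁
IIHasWS-A F = Σ (StratII-A F) (IIWins-A F)

-- The game 𝔊(F⁺, [ω]^{<ω}, F*):  I plays X_k ∈ F⁺, II plays a nonempty
-- finite s_k ⊆ X_k, II wins iff ⋃ s_k ∈ F*.

StratI-B : Family → Set₁
StratI-B F = List (List⁺ ℕ) → Σ SubsetOfω (F ⁺)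

StratII-B : Family → Set₁
StratII-B F = List (Σ SubsetOfω (F ⁺)) → (X : Σ SubsetOfω (F ⁺)) →
  Σ (List⁺ ℕ) (λ s → All (proj₁ X) (toList s))

IWins-B : (F : Family) → StratI-B F → Set₁
IWins-B F τ = (s : ℕ → List⁺ ℕ) → (∀ k → All (proj₁ (τ (init s k))) (toList (s k))) →
  ¬ (F *) (⋃ s)

IIWins-B : (F : Family) → StratII-B F → Set₁
IIWins-B F σ = (X : ℕ → Σ SubsetOfω (F ⁺)) →
  (F *) (⋃ (λ k → proj₁ (σ (init X k) (X k))))

IHasWS-B : Family → Set₁
IHasWS-B F = Σ (StratI-B F) (IWins-B F)

IIHasWS-B : Family → Set₁
IIHasWS-B F = Σ (StratII-B F) (IIWins-B F)

DualBA : Family → Set₁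
DualBA F = (IHasWS-B F ⇔ IIHasWS-A F) × (IIHasWS-B F ⇔ IHasWS-A F)

ω+Diagonalizable : Family → Set₁
ω+Diagonalizable F = Σ (ℕ → SubsetOfω) λ X →
  (∀ n → (F ⁺) (X n)) × (∀ Y → F Y → ∃ λ n → Finite (X n ∖ Y))

record IsFTree (F : Family) (T : Pred (List ℕ) 0ℓ) : Set₁ where
  field
    root       : T []
    prefix     : ∀ s t → T (s ++ t) → T s
    splitting  : ∀ s → T s → Σ SubsetOfω λ X → F X × (∀ n → X n → T (s ++ [ n ]))

IsBranch : Pred (List ℕ) 0ℓ → (ℕ → ℕ) → Set
IsBranch T b = ∀ k → T (init b k)

WeaklyRamsey : Family → Set₁
WeaklyRamsey F = (T : Pred (List ℕ) 0ℓ) → IsFTree F T →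
  Σ (ℕ → ℕ) λ b → IsBranch T b × (F ⁺) (range b)

-- Against I's strategy in
-- 𝔊(F⁺, [ω]^{<ω}, F*), player II of 𝔊(F, ω, F⁺) answers X ∈ F by a point of X inside the
-- current positive set of that strategy.  Against II's strategy in 𝔊(F⁺, [ω]^{<ω}, F*),
-- player I of 𝔊(F, ω, F⁺) plays the set of points the strategy could still put into its
-- answer; it lies in F because its complement, if positive, would be answered inside itself.
-- The plays legal for a strategy of I in 𝔊(F, ω, F⁺) form an F-tree whose branches are
-- those plays; conversely, given an F-tree without positive branch, II of
-- 𝔊(F⁺, [ω]^{<ω}, F*) wins by climbing it with one point of each positive set.  The sets of
-- possible answers of a strategy of II in 𝔊(F, ω, F⁺) after each history diagonalize F when
-- it wins; conversely I wins 𝔊(F⁺, [ω]^{<ω}, F*) by playing the diagonalizing sets in turn,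
-- each one infinitely often.
module Submission where

open import Level using (0ℓ; lift; lower) renaming (suc to lsuc)
open import Axiom.ExcludedMiddle using (ExcludedMiddle)
open import Axiom.DoubleNegationElimination using (DoubleNegationElimination; em⇒dne)
open import Data.Empty using (⊥-elim)
open import Data.Unit using (⊤; tt)
open import Data.Nat using (ℕ; zero; suc; _+_; _≤_; _<_; z≤n; s≤s)
open import Data.Nat.Properties using (≤-trans; n≤1+n; m≤n*m; ≰⇒>; ≤⇒≯; <-≤-trans; m≤m+n; m≤n+m)
import Data.Nat.Binary as ℕᵇ
open import Data.Nat.Binary.Properties using (fromℕ-toℕ)
open import Data.List using (List; []; _∷_; _++_; [_]; map; upTo; length; replicate)
open import Data.List.Properties using (map-++; upTo-∷ʳ; ++-identityʳ; ++-assoc; length-map; length-upTo; length-replicate)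
import Data.List.NonEmpty as List⁺
open import Data.List.NonEmpty using (List⁺; toList)
open import Data.List.Relation.Unary.All as All using (_∷_; [])
open import Data.List.Relation.Unary.Any using (here)
open import Data.List.Membership.Propositional using (_∈_)
open import Data.Product using (Σ; ∃; _×_; _,_; proj₁; proj₂; map₁)
open import Function using (_∘_)
open import Function.Bundles using (_⇔_; mk⇔)
open import Relation.Nullary using (¬_; Dec; yes; no)
open import Relation.Nullary.Decidable using (True; fromWitness; toWitness; map′)
open import Relation.Binary.PropositionalEquality using (_≡_; refl; sym; trans; cong; subst; module ≡-Reasoning)
open import Relation.Unary using (Pred; _⊆_; _∩_; ∁; U)

open import Defs

private
  variable
    X Y Z : SubsetOfω

init-∷ʳ : ∀ {a} {A : Set a} (f : ℕ → A) k → init f (suc k) ≡ init f k ++ [ f k ]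
init-∷ʳ f k = trans (cong (map f) (sym (upTo-∷ʳ k))) (map-++ f (upTo k) [ k ])

length-init : ∀ {a} {A : Set a} (f : ℕ → A) k → length (init f k) ≡ k
length-init f k = trans (length-map f (upTo k)) (length-upTo k)

module Respond {a b} {A : Set a} {B : Set b} (reply : List B → A → B) where

  repliesAfter : List B → List A → List B
  repliesAfter acc [] = acc
  repliesAfter acc (x ∷ xs) = repliesAfter (acc ++ [ reply acc x ]) xs

  replies : List A → List B
  replies = repliesAfter []

  repliesAfter-∷ʳ : ∀ acc xs x →
    repliesAfter acc (xs ++ [ x ]) ≡ repliesAfter acc xs ++ [ reply (repliesAfter acc xs) x ]
  repliesAfter-∷ʳ acc [] x = refl
  repliesAfter-∷ʳ acc (y ∷ ys) x = repliesAfter-∷ʳ (acc ++ [ reply acc y ]) ys x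

  replySeq : (ℕ → A) → ℕ → B
  replySeq f k = reply (replies (init f k)) (f k)

  init-replySeq : ∀ f k → init (replySeq f) k ≡ replies (init f k)
  init-replySeq f zero = refl
  init-replySeq f (suc k) = begin
    init (replySeq f) (suc k)                                     ≡⟨ init-∷ʳ (replySeq f) k ⟩
    init (replySeq f) k ++ [ replySeq f k ]                       ≡⟨ cong (_++ [ replySeq f k ]) (init-replySeq f k) ⟩
    replies (init f k) ++ [ reply (replies (init f k)) (f k) ]    ≡⟨ sym (repliesAfter-∷ʳ [] (init f k) (f k)) ⟩
    replies (init f k ++ [ f k ])                                 ≡⟨ cong replies (sym (init-∷ʳ f k)) ⟩
    replies (init f (suc k))                                      ∎
    where open ≡-Reasoning

build : ∀ {a} {A : Set a} → (List A → A) → ℕ → A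
build next = Respond.replySeq (λ acc (_ : ⊤) → next acc) (λ _ → tt)

build-init : ∀ {a} {A : Set a} (next : List A → A) k → build next k ≡ next (init (build next) k)
build-init next k = cong next (sym (Respond.init-replySeq (λ acc (_ : ⊤) → next acc) (λ _ → tt) k))

-- Lists of naturals in bijection with binary naturals: a head 0 is the digit 2[1+_],
-- incrementing the head is the digit 1+[2_].
incHead : List ℕ → List ℕ
incHead [] = []
incHead (a ∷ l) = suc a ∷ l

decodeᵇ : ℕᵇ.ℕᵇ → List ℕ
decodeᵇ ℕᵇ.zero = []
decodeᵇ ℕᵇ.2[1+ x ] = 0 ∷ decodeᵇ x
decodeᵇ ℕᵇ.1+[2 x ] = incHead (decodeᵇ x)

encodeᵇ : List ℕ → ℕᵇ.ℕᵇ
encodeᵇ [] = ℕᵇ.zero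
encodeᵇ (zero ∷ l) = ℕᵇ.2[1+ encodeᵇ l ]
encodeᵇ (suc a ∷ l) = ℕᵇ.1+[2 encodeᵇ (a ∷ l) ]

decodeᵇ-encodeᵇ : ∀ l → decodeᵇ (encodeᵇ l) ≡ l
decodeᵇ-encodeᵇ [] = refl
decodeᵇ-encodeᵇ (zero ∷ l) = cong (0 ∷_) (decodeᵇ-encodeᵇ l)
decodeᵇ-encodeᵇ (suc a ∷ l) = cong incHead (decodeᵇ-encodeᵇ (a ∷ l))

decode : ℕ → List ℕ
decode = decodeᵇ ∘ ℕᵇ.fromℕ

code : List ℕ → ℕ
code = ℕᵇ.toℕ ∘ encodeᵇ

decode-code : ∀ l → decode (code l) ≡ l
decode-code l = trans (cong decodeᵇ (fromℕ-toℕ (encodeᵇ l))) (decodeᵇ-encodeᵇ l)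

length≤code : ∀ l → length l ≤ code l
length≤code [] = z≤n
length≤code (zero ∷ l) = ≤-trans (s≤s (length≤code l)) (m≤n*m (suc (code l)) 2)
length≤code (suc a ∷ l) = ≤-trans (length≤code (a ∷ l)) (≤-trans (m≤n*m (code (a ∷ l)) 2) (n≤1+n _))

head₀ : List ℕ → ℕ
head₀ [] = 0
head₀ (a ∷ _) = a

cycle : ℕ → ℕ
cycle = head₀ ∘ decode

cycle-hits-late : ∀ n c → ∃ λ k → c ≤ k × cycle k ≡ n
cycle-hits-late n c = code l , c≤code , cong head₀ (decode-code l)
  where
    l : List ℕ
    l = n ∷ replicate c 0
    c≤code : c ≤ code l
    c≤code = ≤-trans (n≤1+n c) (subst (_≤ code l) (cong suc (length-replicate c)) (length≤code l))

infinite-mono : X ⊆ Y → Infinite X → Infinite Y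
infinite-mono X⊆Y ∞X (b , bound) = ∞X (b , λ n Xn → bound n (X⊆Y Xn))

⁺-mono : (F : Family) → X ⊆ Y → (F ⁺) X → (F ⁺) Y
⁺-mono F X⊆Y X⁺ Z FZ = infinite-mono (map₁ X⊆Y) (X⁺ Z FZ)

⋃-singletons⊆range : (f : ℕ → ℕ) → ⋃ (λ k → List⁺.[ f k ]) ⊆ range f
⋃-singletons⊆range f (k , here m≡fk) = k , sym m≡fk

module _ {F : Family} (isF : IsFilter F) where
  open IsFilter isF

  U∈F : F U
  U∈F = cofinite (0 , λ n ¬⊤ → ⊥-elim (¬⊤ tt))

  tail∈F : ∀ b → F (b ≤_)
  tail∈F b = cofinite (b , λ n b≰n → ≰⇒> b≰n)

  ⁺-∩ : (F ⁺) X → F Y → (F ⁺) (X ∩ Y)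
  ⁺-∩ X⁺ FY Z FZ = infinite-mono (λ (x , y , z) → (x , y) , z) (X⁺ _ (∩-closed FY FZ))

module Classical (em : ExcludedMiddle (lsuc 0ℓ)) where

  em₀ : ExcludedMiddle 0ℓ
  em₀ = map′ lower lift em

  dne : DoubleNegationElimination (lsuc 0ℓ)
  dne = em⇒dne em

  dne₀ : DoubleNegationElimination 0ℓ
  dne₀ = em⇒dne em₀

  -- The truth value of a proposition in Set₁, as a proposition in Set; this is how
  -- subsets of ω quantifying over moves (which live in Set₁) are formed.
  Resize : Set₁ → Set
  Resize P = True (em {P})

  resize : ∀ {P} → P → Resize P
  resize = fromWitness

  unresize : ∀ {P} → Resize P → P
  unresize = toWitness

  choose : ∀ {A : Set₁} {P : A → Set} → A → Dec (Σ A P) → A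
  choose a (yes (x , _)) = x
  choose a (no _) = a

  choose-spec : ∀ {A : Set₁} {P : A → Set} (a : A) (d : Dec (Σ A P)) → Σ A P → P (choose a d)
  choose-spec a (yes (_ , Px)) _ = Px
  choose-spec a (no ¬∃) w = ⊥-elim (¬∃ w)

  ε : {A : Set₁} → A → (A → Set) → A
  ε a P = choose {P = P} a em

  ε-spec : ∀ {A : Set₁} (a : A) (P : A → Set) → Σ A P → P (ε a P)
  ε-spec a P = choose-spec {P = P} a em

  infinite⇒inhabited : Infinite X → Σ ℕ X
  infinite⇒inhabited ∞X = dne₀ (λ ¬∃ → ∞X (0 , λ n Xn → ⊥-elim (¬∃ (n , Xn))))

  ⊆*-infinite-∩ : Finite (X ∖ Y) → Infinite (Z ∩ X) → Infinite (Z ∩ Y)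
  ⊆*-infinite-∩ {X} {Y} {Z} (b , X∖Y<b) ∞ZX (c , ZY<c) = ∞ZX (b + c , λ n (Zn , Xn) → below n Zn Xn)
    where
      below : ∀ n → Z n → X n → n < b + c
      below n Zn Xn with em₀ {Y n}
      ... | yes Yn = <-≤-trans (ZY<c n (Zn , Yn)) (m≤n+m c b)
      ... | no ¬Yn = <-≤-trans (X∖Y<b n (Xn , ¬Yn)) (m≤m+n b c)

  ¬⁺⇒∁∈F : ∀ {F} → IsFilter F → ¬ (F ⁺) X → F (∁ X)
  ¬⁺⇒∁∈F {X} {F} isF ¬X⁺ with dne (λ ¬Y → ¬X⁺ (λ Y FY fin → ¬Y (Y , FY , fin)))
  ... | Y , FY , (b , bound) =
    ⊇-closed (λ {n} (Yn , b≤n) Xn → ≤⇒≯ b≤n (bound n (Xn , Yn))) (∩-closed FY (tail∈F isF b))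
    where open IsFilter isF

  ¬WeaklyRamsey⇒tree : ∀ {F} → ¬ WeaklyRamsey F →
    Σ (Pred (List ℕ) 0ℓ) λ T → IsFTree F T × (∀ b → IsBranch T b → ¬ (F ⁺) (range b))
  ¬WeaklyRamsey⇒tree ¬wr =
    dne (λ ¬tree → ¬wr (λ T T-tree → dne (λ ¬branch →
      ¬tree (T , T-tree , λ b b-branch b⁺ → ¬branch (b , b-branch , b⁺)))))

module _ {F : Family} (τ : StratI-A F) where

  LegalAfter : List ℕ → List ℕ → Set
  LegalAfter h [] = ⊤
  LegalAfter h (n ∷ s) = proj₁ (τ h) n × LegalAfter (h ++ [ n ]) s

  legal-prefix : ∀ h s t → LegalAfter h (s ++ t) → LegalAfter h s
  legal-prefix h [] t _ = tt
  legal-prefix h (n ∷ s) t (τn , legal) = τn , legal-prefix (h ++ [ n ]) s t legal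

  legal-∷ʳ : ∀ h s n → LegalAfter h s → proj₁ (τ (h ++ s)) n → LegalAfter h (s ++ [ n ])
  legal-∷ʳ h [] n _ τn = subst (λ h′ → proj₁ (τ h′) n) (++-identityʳ h) τn , tt
  legal-∷ʳ h (m ∷ s) n (τm , legal) τn =
    τm , legal-∷ʳ (h ++ [ m ]) s n legal (subst (λ h′ → proj₁ (τ h′) n) (sym (++-assoc h [ m ] s)) τn)

  legal-last : ∀ h s n → LegalAfter h (s ++ [ n ]) → proj₁ (τ (h ++ s)) n
  legal-last h [] n (τn , _) = subst (λ h′ → proj₁ (τ h′) n) (sym (++-identityʳ h)) τn
  legal-last h (m ∷ s) n (_ , legal) =
    subst (λ h′ → proj₁ (τ h′) n) (++-assoc h [ m ] s) (legal-last (h ++ [ m ]) s n legal)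

  legal-tree : IsFTree F (LegalAfter [])
  legal-tree = record
    { root      = tt
    ; prefix    = legal-prefix []
    ; splitting = λ s legal → proj₁ (τ s) , proj₂ (τ s) , λ n τn → legal-∷ʳ [] s n legal τn
    }

  legal-tree-branch : ∀ b → IsBranch (LegalAfter []) b → ∀ k → proj₁ (τ (init b k)) (b k)
  legal-tree-branch b b-branch k =
    legal-last [] (init b k) (b k) (subst (LegalAfter []) (init-∷ʳ b k) (b-branch (suc k)))

IHasWS-A⇒¬WeaklyRamsey : (F : Family) → IHasWS-A F → ¬ WeaklyRamsey F
IHasWS-A⇒¬WeaklyRamsey F (τ , τ-wins) wr =
  let (b , b-branch , b⁺) = wr (LegalAfter τ []) (legal-tree τ)
  in τ-wins b (legal-tree-branch τ b b-branch) b⁺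

module _ (em : ExcludedMiddle (lsuc 0ℓ)) where
  open Classical em

  module _ (F : Family) (τ : StratI-B F) (τ-wins : IWins-B F τ) where

    meet : ∀ h (X : Σ SubsetOfω F) → Σ ℕ (proj₁ (τ h) ∩ proj₁ X)
    meet h (X , FX) = infinite⇒inhabited (proj₂ (τ h) X FX)

    open Respond (λ h X → List⁺.[ proj₁ (meet h X) ])

    shadow : StratII-A F
    shadow Xs X = proj₁ (meet (replies Xs) X) , proj₂ (proj₂ (meet (replies Xs) X))

    shadow-wins : IIWins-A F shadow
    shadow-wins Xs = ⁺-mono F (⋃-singletons⊆range _) (dne (τ-wins (replySeq Xs) legal))
      where
        legal : ∀ k → All.All (proj₁ (τ (init (replySeq Xs) k))) (toList (replySeq Xs k))
        legal k = subst (λ h → proj₁ (τ h) (proj₁ (meet (replies (init Xs k)) (Xs k))))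
                        (sym (init-replySeq Xs k))
                        (proj₁ (proj₂ (meet _ (Xs k))))
                  ∷ []

  IHasWS-B⇒IIHasWS-A : (F : Family) → IHasWS-B F → IIHasWS-A F
  IHasWS-B⇒IIHasWS-A F (τ , τ-wins) = shadow F τ τ-wins , shadow-wins F τ τ-wins

  module _ {F : Family} (isF : IsFilter F) where
    open IsFilter isF

    module _ (T : Pred (List ℕ) 0ℓ) (T-tree : IsFTree F T) where
      open IsFTree T-tree

      extend : ∀ t (Z : Σ SubsetOfω (F ⁺)) → Σ ℕ λ n → proj₁ Z n × (T t → T (t ++ [ n ]))
      extend t (Z , Z⁺) with em₀ {T t}
      ... | yes Tt = let (X , FX , X⊆T) = splitting t Tt
                         (n , Zn , Xn) = infinite⇒inhabited (Z⁺ X FX)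
                     in n , Zn , λ _ → X⊆T n Xn
      ... | no ¬Tt = let (n , Zn , _) = infinite⇒inhabited (Z⁺ U (U∈F isF))
                     in n , Zn , λ Tt → ⊥-elim (¬Tt Tt)

      open Respond (λ t Z → proj₁ (extend t Z))

      tree-follower : StratII-B F
      tree-follower h Z = List⁺.[ proj₁ (extend (replies h) Z) ] , proj₁ (proj₂ (extend (replies h) Z)) ∷ []

      tree-follower-branch : ∀ Zs → IsBranch T (replySeq Zs)
      tree-follower-branch Zs zero = root
      tree-follower-branch Zs (suc k) =
        subst T (sym (init-∷ʳ b k))
          (subst (λ t → T (t ++ [ b k ])) (sym (init-replySeq Zs k))
            (proj₂ (proj₂ (extend _ (Zs k))) (subst T (init-replySeq Zs k) (tree-follower-branch Zs k))))
        where
          b : ℕ → ℕ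
          b = replySeq Zs

      tree-follower-wins : (∀ b → IsBranch T b → ¬ (F ⁺) (range b)) → IIWins-B F tree-follower
      tree-follower-wins no-⁺-branch Zs ⋃⁺ =
        no-⁺-branch (replySeq Zs) (tree-follower-branch Zs) (⁺-mono F (⋃-singletons⊆range (replySeq Zs)) ⋃⁺)

    ¬WeaklyRamsey⇒IIHasWS-B : ¬ WeaklyRamsey F → IIHasWS-B F
    ¬WeaklyRamsey⇒IIHasWS-B ¬wr =
      let (T , T-tree , no-⁺-branch) = ¬WeaklyRamsey⇒tree ¬wr
      in tree-follower T T-tree , tree-follower-wins T T-tree no-⁺-branch

    -- Z₀ is only the default value of ε; F⁺ is empty when F contains a finite set.
    module _ (σ : StratII-B F) (σ-wins : IIWins-B F σ) (Z₀ : Σ SubsetOfω (F ⁺)) where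

      Possible : List (Σ SubsetOfω (F ⁺)) → SubsetOfω
      Possible h n = Resize (Σ (Σ SubsetOfω (F ⁺)) λ Z → n ∈ toList (proj₁ (σ h Z)))

      Possible∈F : ∀ h → F (Possible h)
      Possible∈F h = ⊇-closed dne₀ (¬⁺⇒∁∈F isF impossible-not-⁺)
        where
          impossible-not-⁺ : ¬ (F ⁺) (∁ (Possible h))
          impossible-not-⁺ C⁺ = All.head (proj₂ (σ h C)) (resize (C , here refl))
            where
              C : Σ SubsetOfω (F ⁺)
              C = ∁ (Possible h) , C⁺

      provoke : List (Σ SubsetOfω (F ⁺)) → ℕ → Σ SubsetOfω (F ⁺)
      provoke h n = ε Z₀ (λ Z → n ∈ toList (proj₁ (σ h Z)))

      open Respond provoke

      possibilities : StratI-A F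
      possibilities ns = Possible (replies ns) , Possible∈F (replies ns)

      possibilities-wins : IWins-A F possibilities
      possibilities-wins ns legal ns⁺ = σ-wins Zs (⁺-mono F range⊆⋃ ns⁺)
        where
          Zs : ℕ → Σ SubsetOfω (F ⁺)
          Zs = replySeq ns
          range⊆⋃ : range ns ⊆ ⋃ (λ k → proj₁ (σ (init Zs k) (Zs k)))
          range⊆⋃ (k , refl) =
            k , subst (λ h → ns k ∈ toList (proj₁ (σ h (Zs k)))) (sym (init-replySeq ns k))
                      (ε-spec Z₀ _ (unresize (legal k)))

    IIHasWS-B⇒IHasWS-A : IIHasWS-B F → IHasWS-A F
    IIHasWS-B⇒IHasWS-A (σ , σ-wins) with em {Σ SubsetOfω (F ⁺)}
    ... | yes Z₀ = possibilities σ σ-wins Z₀ , possibilities-wins σ σ-wins Z₀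
    ... | no ¬Z = (λ _ → U , U∈F isF) , λ ns _ ns⁺ → ¬Z (range ns , ns⁺)

    module _ (σ : StratII-A F) (σ-wins : IIWins-A F σ) where

      Answers : List (Σ SubsetOfω F) → SubsetOfω
      Answers p n = Resize (Σ (Σ SubsetOfω F) λ X → proj₁ (σ p X) ≡ n)

      Answers⁺ : ∀ p → (F ⁺) (Answers p)
      Answers⁺ p Y FY (c , bound) =
        let (Ym , c≤m) = proj₂ (σ p Y≥c) in ≤⇒≯ c≤m (bound _ (resize (Y≥c , refl) , Ym))
        where
          Y≥c : Σ SubsetOfω F
          Y≥c = Y ∩ (c ≤_) , ∩-closed FY (tail∈F isF c)

      challenge : List (Σ SubsetOfω F) → ℕ → Σ SubsetOfω F
      challenge p n = ε (U , U∈F isF) (λ X → proj₁ (σ p X) ≡ n)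

      open Respond challenge

      -- If σ could answer outside Y after every history, I would provoke such answers
      -- forever, and the range of σ's answers would miss Y ∈ F.
      cannot-avoid : ∀ Y → F Y → ¬ (∀ t → Σ ℕ (Answers (replies t) ∖ Y))
      cannot-avoid Y FY avoid =
        σ-wins Xs Y FY (0 , λ m ((k , σk≡m) , Ym) →
          ⊥-elim (proj₂ (avoids k) (subst Y (trans (sym σk≡m) (σ-answers k)) Ym)))
        where
          ns : ℕ → ℕ
          ns = build (proj₁ ∘ avoid)
          avoids : ∀ k → (Answers (replies (init ns k)) ∖ Y) (ns k)
          avoids k = subst (Answers (replies (init ns k)) ∖ Y) (sym (build-init (proj₁ ∘ avoid) k))
                           (proj₂ (avoid (init ns k)))
          Xs : ℕ → Σ SubsetOfω F
          Xs = replySeq ns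
          σ-answers : ∀ k → proj₁ (σ (init Xs k) (Xs k)) ≡ ns k
          σ-answers k = subst (λ p → proj₁ (σ p (Xs k)) ≡ ns k) (sym (init-replySeq ns k))
                              (ε-spec _ _ (unresize (proj₁ (avoids k))))

    IIHasWS-A⇒ω+Diagonalizable : IIHasWS-A F → ω+Diagonalizable F
    IIHasWS-A⇒ω+Diagonalizable (σ , σ-wins) = Xs , (λ i → Answers⁺ σ σ-wins _) , diagonal
      where
        Xs : ℕ → SubsetOfω
        Xs i = Answers σ σ-wins (Respond.replies (challenge σ σ-wins) (decode i))
        diagonal : ∀ Y → F Y → ∃ λ i → Finite (Xs i ∖ Y)
        diagonal Y FY = dne₀ λ ¬fin → cannot-avoid σ σ-wins Y FY λ t →
          subst (λ l → Σ ℕ (Answers σ σ-wins (Respond.replies (challenge σ σ-wins) l) ∖ Y)) (decode-code t)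
                (infinite⇒inhabited λ fin → ¬fin (code t , fin))

    module _ (Xs : ℕ → SubsetOfω) (Xs⁺ : ∀ n → (F ⁺) (Xs n))
             (diag : ∀ Y → F Y → ∃ λ n → Finite (Xs n ∖ Y)) where

      round-robin : StratI-B F
      round-robin h = Xs (cycle k) ∩ (k ≤_) , ⁺-∩ isF (Xs⁺ (cycle k)) (tail∈F isF k)
        where k = length h

      round-robin-wins : IWins-B F round-robin
      round-robin-wins s legal ¬⋃⁺ = ¬⋃⁺ λ Y FY → ⊆*-infinite-∩ (proj₂ (diag Y FY)) (meets (proj₁ (diag Y FY)))
        where
          meets : ∀ n → Infinite (⋃ s ∩ Xs n)
          meets n (c , bound) with cycle-hits-late n c
          ... | k , c≤k , refl =
            let (Xh , k≤h) = subst (λ j → (Xs (cycle j) ∩ (j ≤_)) (List⁺.head (s k))) (length-init s k) (All.head (legal k))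
            in ≤⇒≯ (≤-trans c≤k k≤h) (bound _ ((k , here refl) , Xh))

    ω+Diagonalizable⇒IHasWS-B : ω+Diagonalizable F → IHasWS-B F
    ω+Diagonalizable⇒IHasWS-B (Xs , Xs⁺ , diag) = round-robin Xs Xs⁺ diag , round-robin-wins Xs Xs⁺ diag

theorem2p22 : ExcludedMiddle (lsuc 0ℓ) → (F : Family) → IsFilter F →
    DualBA F × ((IHasWS-B F ⇔ ω+Diagonalizable F) × (IIHasWS-B F ⇔ (¬ WeaklyRamsey F)))
theorem2p22 em F isF =
  (mk⇔ IB⇒IIA (IB⇐diag ∘ IIA⇒diag) , mk⇔ IIB⇒IA (IIB⇐¬WR ∘ IA⇒¬WR)) ,
  mk⇔ (IIA⇒diag ∘ IB⇒IIA) IB⇐diag ,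
  mk⇔ (IA⇒¬WR ∘ IIB⇒IA) IIB⇐¬WR
  where
    IB⇒IIA : IHasWS-B F → IIHasWS-A F
    IB⇒IIA = IHasWS-B⇒IIHasWS-A em F
    IIA⇒diag : IIHasWS-A F → ω+Diagonalizable F
    IIA⇒diag = IIHasWS-A⇒ω+Diagonalizable em isF
    IB⇐diag : ω+Diagonalizable F → IHasWS-B F
    IB⇐diag = ω+Diagonalizable⇒IHasWS-B em isF
    IIB⇒IA : IIHasWS-B F → IHasWS-A F
    IIB⇒IA = IIHasWS-B⇒IHasWS-A em isF
    IA⇒¬WR : IHasWS-A F → ¬ WeaklyRamsey F
    IA⇒¬WR = IHasWS-A⇒¬WeaklyRamsey F
    IIB⇐¬WR : ¬ WeaklyRamsey F → IIHasWS-B F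
    IIB⇐¬WR = ¬WeaklyRamsey⇒IIHasWS-B em isF
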